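{- Let $q\ge1$ and let $h,k$ be coprime positive integers. For a positive integer $d$ write $d_{(h)}=d/(d,h)$ and $d_{(k)}=d/(d,k)$, and define $P_{11}=\{d\ge1:(d_{(h)},q)=1,\ (d_{(k)},q)=1\}$, $P_{22}=\{d\ge1:(d_{(h)},q)=q,\ (d_{(k)},q)=q\}$, $P_{12}=\{d\ge1:(d_{(h)},q)=1,\ (d_{(k)},q)=q\}$, $P_{21}=\{d\ge1:(d_{(h)},q)=q,\ (d_{(k)},q)=1\}$. Then $P_{11}=\{d\ge1:(d,q)=1\}$ and $P_{22}=\{d\ge1: d=q\,h(q)\,k(q)\,l \text{ for some } l\ge1\}$. If $q\mid h$ then $P_{12}=\{d\ge1: d=qml,\ l\ge1,\ (l,q)=1,\ m\mid h(q)/q\}$, and otherwise $P_{12}=\emptyset$. Similarly, if $q\mid k$ then $P_{21}=\{d\ge1: d=qnl,\ l\ge1,\ (l,q)=1,\ n\mid k(q)/q\}$, and otherwise $P_{21}=\emptyset$.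
   Context: For a positive integer $n$ with prime factorization $n=\prod_p p^{n_p}$, its $q$-part is $n(q)=\prod_{p\mid n,\ p\mid q}p^{n_p}$. -}

module Defs where

open import Data.Nat using (ℕ; NonZero; ≢-nonZero; ≢-nonZero⁻¹; _/_)
open import Data.Nat.GCD using (gcd; gcd[m,n]≢0)
open import Data.Nat.Divisibility using (_∣?_)
open import Data.Nat.Primality.Factorisation using (factorise; PrimeFactorisation)
open import Data.List using (filter)
open import Data.Nat.ListAction using (product)
open import Data.Sum using (inj₂)

-- q-part of n: n(q) = ∏_{p ∣ n, p ∣ q} p^{n_p}, i.e. the product of those
-- prime factors of n (listed with multiplicity) which divide q.
qPart : (n : ℕ) → .{{NonZero n}} → (q : ℕ) → ℕ
qPart n q = product (filter (_∣? q) (PrimeFactorisation.factors (factorise n)))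

reduce : (d h : ℕ) → .{{NonZero h}} → ℕ
reduce d h = _/_ d (gcd d h) {{≢-nonZero (gcd[m,n]≢0 d h (inj₂ (≢-nonZero⁻¹ h)))}}

{-# OPTIONS --safe #-}
-- Write d = d_(h) (d , h), and h = h(q) h′ with h′ coprime to q and every prime
-- of h(q) dividing q. A divisor of both d and q that is coprime to d_(h) lies in
-- (d , h), hence divides h: this gives P₁₁, and P₁₂ = ∅ when q ∤ h. Primes of q
-- can enter (d , h) only through h(q), so q ∣ d_(h) iff q h(q) ∣ d; P₂₂ follows
-- since (h(q) , k(q)) = 1. For P₁₂ split d into its q-part D and a cofactor
-- coprime to q: D is coprime to d_(h), so D ∣ (d , h) and therefore D ∣ h(q).
module Submission where

open import Defs
open import Data.Nat using (ℕ; NonZero; zero; suc; _*_; _/_; _^_; _≥_; ≢-nonZero; ≢-nonZero⁻¹; >-nonZero; >-nonZero⁻¹)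
open import Data.Nat.Properties using (*-comm; *-assoc; *-identityˡ; *-zeroʳ; m*n≢0; *-commutativeSemigroup)
open import Data.Nat.DivMod using (m/n*n≡m; m*[n/m]≡n; m*n/m*o≡n/o)
open import Data.Nat.GCD using (gcd; gcd[m,n]∣m; gcd[m,n]∣n; gcd-greatest; gcd[m,n]≢0; c*gcd[m,n]≡gcd[cm,cn])
open import Data.Nat.LCM using (lcm; lcm-least; gcd*lcm)
open import Data.Nat.Divisibility
open import Data.Nat.Coprimality using (Coprime; coprime-divisor; coprime-/gcd; coprime⇒gcd≡1; gcd≡1⇒coprime)
  renaming (sym to coprime-sym)
open import Data.Nat.Primality using (Prime; prime⇒irreducible)
open import Data.Nat.Primality.Factorisation using (factorise; PrimeFactorisation)
open import Data.Nat.ListAction using (product)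
open import Data.List using (List; []; _∷_; filter; length)
open import Data.List.Relation.Unary.All using (All; []; _∷_)
open import Data.Product using (_×_; _,_; ∃-syntax; swap)
open import Data.Sum using (inj₁; inj₂)
open import Data.Empty using (⊥-elim)
open import Function.Bundles using (_⇔_; mk⇔; Equivalence)
import Function.Properties.Equivalence as ⇔
open import Relation.Nullary using (¬_; yes; no; ¬?)
open import Relation.Binary.PropositionalEquality using (_≡_; refl; sym; trans; cong; subst; module ≡-Reasoning)
open import Algebra.Properties.CommutativeSemigroup *-commutativeSemigroup using (x∙yz≈y∙xz)

gcd≢0ʳ : ∀ m n .{{_ : NonZero n}} → NonZero (gcd m n)
gcd≢0ʳ m n = ≢-nonZero (gcd[m,n]≢0 m n (inj₂ (≢-nonZero⁻¹ n)))

coprime-∣ʳ : ∀ {a b c} → b ∣ c → Coprime a c → Coprime a b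
coprime-∣ʳ b∣c cop (i∣a , i∣b) = cop (i∣a , ∣-trans i∣b b∣c)

coprime-∣ˡ : ∀ {a b c} → a ∣ b → Coprime b c → Coprime a c
coprime-∣ˡ a∣b cop = coprime-sym (coprime-∣ʳ a∣b (coprime-sym cop))

coprime-*ˡ : ∀ {a b c} → Coprime a c → Coprime b c → Coprime (a * b) c
coprime-*ˡ ca cb (i∣ab , i∣c) =
  cb (coprime-divisor (coprime-sym (coprime-∣ʳ i∣c ca)) i∣ab , i∣c)

coprime-^ˡ : ∀ {a c} e → Coprime a c → Coprime (a ^ e) c
coprime-^ˡ zero    _  (i∣1 , _) = ∣1⇒≡1 i∣1
coprime-^ˡ (suc e) ca = coprime-*ˡ ca (coprime-^ˡ e ca)

∣q^e⇒coprime : ∀ {x q y} e → x ∣ q ^ e → Coprime q y → Coprime x y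
∣q^e⇒coprime e x∣q^e cop = coprime-∣ˡ x∣q^e (coprime-^ˡ e cop)

prime∤⇒coprime : ∀ {p n} → Prime p → ¬ p ∣ n → Coprime p n
prime∤⇒coprime pr p∤n (i∣p , i∣n) with prime⇒irreducible pr i∣p
... | inj₁ i≡1 = i≡1
... | inj₂ refl = ⊥-elim (p∤n i∣n)

coprime⇒m*n∣o : ∀ {m n o} → Coprime m n → m ∣ o → n ∣ o → m * n ∣ o
coprime⇒m*n∣o {m} {n} {o} cop m∣o n∣o = subst (_∣ o) lcm≡m*n (lcm-least m∣o n∣o)
  where
  lcm≡m*n : lcm m n ≡ m * n
  lcm≡m*n = trans (sym (*-identityˡ (lcm m n)))
                  (subst (λ g → g * lcm m n ≡ m * n) (coprime⇒gcd≡1 cop) (gcd*lcm m n))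

coprime⇒c*m*n∣o : ∀ {c m n o} .{{_ : NonZero c}} → Coprime m n → c * m ∣ o → c * n ∣ o → c * m * n ∣ o
coprime⇒c*m*n∣o {c} {m} {n} {o} cop cm∣o cn∣o =
  subst (_∣ o) (sym (*-assoc c m n))
    (m∣n/o⇒o*m∣n (m*n∣⇒m∣ c m cm∣o)
      (coprime⇒m*n∣o cop (m*n∣o⇒n∣o/m c m cm∣o) (m*n∣o⇒n∣o/m c n cn∣o)))

gcd≡⇒∣ : ∀ {m n} → gcd m n ≡ n → n ∣ m
gcd≡⇒∣ {m} e = subst (_∣ m) e (gcd[m,n]∣m m _)

∣⇒gcd≡ : ∀ {m n} → n ∣ m → gcd m n ≡ n
∣⇒gcd≡ {m} {n} n∣m = ∣-antisym (gcd[m,n]∣n m n) (gcd-greatest n∣m ∣-refl)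

∣⇒∃[≥1] : ∀ {m d} .{{_ : NonZero d}} → m ∣ d → ∃[ l ] (l ≥ 1 × d ≡ m * l)
∣⇒∃[≥1] m∣d = quotient m∣d , >-nonZero⁻¹ _ {{quotient≢0 m∣d}} , m∣n⇒n≡m*quotient m∣d

qComplement : (n : ℕ) → .{{NonZero n}} → (q : ℕ) → ℕ
qComplement n q = product (filter (λ p → ¬? (p ∣? q)) (PrimeFactorisation.factors (factorise n)))

module _ (q : ℕ) where

  private
    dividing nondividing : List ℕ → ℕ
    dividing    ps = product (filter (_∣? q) ps)
    nondividing ps = product (filter (λ p → ¬? (p ∣? q)) ps)

  dividing*nondividing : ∀ ps → dividing ps * nondividing ps ≡ product ps
  dividing*nondividing []       = refl
  dividing*nondividing (p ∷ ps) with p ∣? q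
  ... | yes _ = trans (*-assoc p _ _) (cong (p *_) (dividing*nondividing ps))
  ... | no  _ = trans (x∙yz≈y∙xz (dividing ps) p _) (cong (p *_) (dividing*nondividing ps))

  dividing∣q^length : ∀ ps → dividing ps ∣ q ^ length ps
  dividing∣q^length []       = ∣-refl
  dividing∣q^length (p ∷ ps) with p ∣? q
  ... | yes p∣q = *-pres-∣ p∣q (dividing∣q^length ps)
  ... | no  _   = ∣n⇒∣m*n q (dividing∣q^length ps)

  nondividing-coprime : ∀ {ps} → All Prime ps → Coprime (nondividing ps) q
  nondividing-coprime {[]}     _ (i∣1 , _) = ∣1⇒≡1 i∣1
  nondividing-coprime {p ∷ ps} (pr ∷ prs) with p ∣? q
  ... | yes _   = nondividing-coprime prs
  ... | no  p∤q = coprime-*ˡ (prime∤⇒coprime pr p∤q) (nondividing-coprime prs)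

module _ (n : ℕ) .{{_ : NonZero n}} (q : ℕ) where

  open PrimeFactorisation (factorise n) using (factors; isFactorisation; factorsPrime)

  qPart*qComplement : qPart n q * qComplement n q ≡ n
  qPart*qComplement = trans (dividing*nondividing q factors) (sym isFactorisation)

  qPart∣n : qPart n q ∣ n
  qPart∣n = divides (qComplement n q)
    (trans (sym qPart*qComplement) (*-comm (qPart n q) (qComplement n q)))

  qPart∣q^ : ∃[ e ] qPart n q ∣ q ^ e
  qPart∣q^ = length factors , dividing∣q^length q factors

  qComplement-coprime : Coprime (qComplement n q) q
  qComplement-coprime = nondividing-coprime q factorsPrime

  qPart-nonZero : NonZero (qPart n q)
  qPart-nonZero = ≢-nonZero λ X≡0 →
    ≢-nonZero⁻¹ n (trans (sym qPart*qComplement) (cong (_* qComplement n q) X≡0))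

  qComplement-nonZero : NonZero (qComplement n q)
  qComplement-nonZero = ≢-nonZero λ Y≡0 →
    ≢-nonZero⁻¹ n (trans (sym qPart*qComplement) (trans (cong (qPart n q *_) Y≡0) (*-zeroʳ (qPart n q))))

∣q^e⇒∣qPart : ∀ {x q} n .{{_ : NonZero n}} e → x ∣ q ^ e → x ∣ n → x ∣ qPart n q
∣q^e⇒∣qPart {x} {q} n e x∣q^e x∣n = coprime-divisor x⊥Y (subst (x ∣_) (sym n≡Y*X) x∣n)
  where
  x⊥Y : Coprime x (qComplement n q)
  x⊥Y = ∣q^e⇒coprime e x∣q^e (coprime-sym (qComplement-coprime n q))
  n≡Y*X : qComplement n q * qPart n q ≡ n
  n≡Y*X = trans (*-comm (qComplement n q) (qPart n q)) (qPart*qComplement n q)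

∣⇒∣qPart : ∀ {q} n .{{_ : NonZero n}} → q ∣ n → q ∣ qPart n q
∣⇒∣qPart {q} n = ∣q^e⇒∣qPart {q} {q} n 1 (m∣m*n 1)

reduce*gcd : ∀ d h .{{_ : NonZero h}} → reduce d h * gcd d h ≡ d
reduce*gcd d h = m/n*n≡m {{gcd≢0ʳ d h}} (gcd[m,n]∣m d h)

reduce∣ : ∀ d h .{{_ : NonZero h}} → reduce d h ∣ d
reduce∣ d h = m/n∣m {{gcd≢0ʳ d h}} (gcd[m,n]∣m d h)

reduce-cong : ∀ {d d′ h h′} .{{_ : NonZero h}} .{{_ : NonZero h′}} →
  d ≡ d′ → h ≡ h′ → reduce d h ≡ reduce d′ h′
reduce-cong refl refl = refl

reduce-*ˡ : ∀ x m y .{{_ : NonZero x}} .{{_ : NonZero y}} → reduce (x * m) (x * y) {{m*n≢0 x y}} ≡ reduce m y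
reduce-*ˡ x m y = begin
  x * m / gcd (x * m) (x * y) ≡⟨ /-congʳ (sym (c*gcd[m,n]≡gcd[cm,cn] x m y)) ⟩
  x * m / (x * gcd m y)       ≡⟨ m*n/m*o≡n/o x m (gcd m y) ⟩
  m / gcd m y                 ∎
  where
  open ≡-Reasoning
  instance
    _ = m*n≢0 x y
    _ = gcd≢0ʳ m y
    _ = gcd≢0ʳ (x * m) (x * y)
    _ = m*n≢0 x (gcd m y)
  /-congʳ : ∀ {n o} .{{_ : NonZero n}} .{{_ : NonZero o}} → n ≡ o → x * m / n ≡ x * m / o
  /-congʳ refl = refl

∣⇒∣reduce : ∀ {q d h} .{{_ : NonZero h}} → Coprime q h → q ∣ d → q ∣ reduce d h
∣⇒∣reduce {q} {d} {h} q⊥h q∣d = coprime-divisor (coprime-∣ʳ (gcd[m,n]∣n d h) q⊥h) q∣g*r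
  where
  q∣g*r : q ∣ gcd d h * reduce d h
  q∣g*r = subst (q ∣_) (trans (sym (reduce*gcd d h)) (*-comm (reduce d h) (gcd d h))) q∣d

coprime-reduce⇒∣ : ∀ {m d} h .{{_ : NonZero h}} → m ∣ d → Coprime m (reduce d h) → m ∣ h
coprime-reduce⇒∣ {m} {d} h m∣d m⊥r =
  ∣-trans (coprime-divisor m⊥r (subst (m ∣_) (sym (reduce*gcd d h)) m∣d)) (gcd[m,n]∣n d h)

reduce-*∣ : ∀ {a l h} .{{_ : NonZero h}} → a ∣ h → reduce (a * l) h ∣ l
reduce-*∣ {a} {l} {h} a∣h = m∣n*o⇒m/n∣o {{gcd≢0ʳ (a * l) h}} (gcd[m,n]∣m (a * l) h) al∣lg
  where
  al∣lg : a * l ∣ l * gcd (a * l) h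
  al∣lg = subst (_∣ l * gcd (a * l) h) (*-comm l a) (*-monoʳ-∣ l (gcd-greatest (m∣m*n l) a∣h))

-- x is made of primes of q, and those cannot divide h / (d , h) once q ∣ d_(h).
∣reduce⇒*∣ : ∀ {q x d h} .{{_ : NonZero h}} e → x ∣ q ^ e → x ∣ h → q ∣ reduce d h → q * x ∣ d
∣reduce⇒*∣ {q} {x} {d} {h} e x∣q^e x∣h q∣r = subst (q * x ∣_) (reduce*gcd d h) (*-pres-∣ q∣r x∣g)
  where
  instance _ = gcd≢0ʳ d h
  x⊥h/g : Coprime x (h / gcd d h)
  x⊥h/g = ∣q^e⇒coprime e x∣q^e (coprime-∣ˡ q∣r (coprime-/gcd d h))
  x∣g : x ∣ gcd d h
  x∣g = coprime-divisor x⊥h/g (subst (x ∣_) (sym (m/n*n≡m (gcd[m,n]∣n d h))) x∣h)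

∣reduce⇔*qPart∣ : ∀ q d h .{{_ : NonZero h}} → q ∣ reduce d h ⇔ q * qPart h q ∣ d
∣reduce⇔*qPart∣ q d h = mk⇔ to from
  where
  X = qPart h q
  Y = qComplement h q
  instance
    X≢0 = qPart-nonZero h q
    Y≢0 = qComplement-nonZero h q
    XY≢0 = m*n≢0 X Y
  to : q ∣ reduce d h → q * X ∣ d
  to = let e , X∣q^e = qPart∣q^ h q in ∣reduce⇒*∣ e X∣q^e (qPart∣n h q)
  from : q * X ∣ d → q ∣ reduce d h
  from (divides c d≡c*qX) =
    subst (q ∣_) (sym r≡) (∣⇒∣reduce (coprime-sym (qComplement-coprime h q)) (n∣m*n c))
    where
    open ≡-Reasoning
    d≡X*cq : d ≡ X * (c * q)
    d≡X*cq = trans d≡c*qX (trans (sym (*-assoc c q X)) (*-comm (c * q) X))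
    r≡ : reduce d h ≡ reduce (c * q) Y
    r≡ = begin
      reduce d h                   ≡⟨ reduce-cong d≡X*cq (sym (qPart*qComplement h q)) ⟩
      reduce (X * (c * q)) (X * Y) ≡⟨ reduce-*ˡ X (c * q) Y ⟩
      reduce (c * q) Y             ∎

gcd-reduce≡[1,1]⇔gcd≡1 : ∀ q d h k .{{_ : NonZero h}} .{{_ : NonZero k}} → Coprime h k →
  (gcd (reduce d h) q ≡ 1 × gcd (reduce d k) q ≡ 1) ⇔ gcd d q ≡ 1
gcd-reduce≡[1,1]⇔gcd≡1 q d h k h⊥k = mk⇔ to from
  where
  to : gcd (reduce d h) q ≡ 1 × gcd (reduce d k) q ≡ 1 → gcd d q ≡ 1
  to (rₕ⊥q , rₖ⊥q) = coprime⇒gcd≡1 {d} {q} λ (i∣d , i∣q) →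
    h⊥k (∣q⇒∣ h rₕ⊥q i∣d i∣q , ∣q⇒∣ k rₖ⊥q i∣d i∣q)
    where
    ∣q⇒∣ : ∀ {i} x .{{_ : NonZero x}} → gcd (reduce d x) q ≡ 1 → i ∣ d → i ∣ q → i ∣ x
    ∣q⇒∣ x rₓ⊥q i∣d i∣q = coprime-reduce⇒∣ x i∣d (coprime-sym (coprime-∣ʳ i∣q (gcd≡1⇒coprime rₓ⊥q)))
  from : gcd d q ≡ 1 → gcd (reduce d h) q ≡ 1 × gcd (reduce d k) q ≡ 1
  from d⊥q = coprime⇒gcd≡1 (coprime-∣ˡ (reduce∣ d h) (gcd≡1⇒coprime {d} d⊥q))
           , coprime⇒gcd≡1 (coprime-∣ˡ (reduce∣ d k) (gcd≡1⇒coprime {d} d⊥q))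

gcd-reduce≡[q,q]⇔ : ∀ q d h k .{{_ : NonZero q}} .{{_ : NonZero h}} .{{_ : NonZero k}} → d ≥ 1 → Coprime h k →
  (gcd (reduce d h) q ≡ q × gcd (reduce d k) q ≡ q) ⇔ (∃[ l ] (l ≥ 1 × d ≡ q * qPart h q * qPart k q * l))
gcd-reduce≡[q,q]⇔ q d h k d≥1 h⊥k = mk⇔ to from
  where
  instance _ = >-nonZero d≥1
  H = qPart h q
  K = qPart k q
  to : gcd (reduce d h) q ≡ q × gcd (reduce d k) q ≡ q → ∃[ l ] (l ≥ 1 × d ≡ q * H * K * l)
  to (q∣rₕ , q∣rₖ) = ∣⇒∃[≥1] (coprime⇒c*m*n∣o H⊥K
    (Equivalence.to (∣reduce⇔*qPart∣ q d h) (gcd≡⇒∣ q∣rₕ))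
    (Equivalence.to (∣reduce⇔*qPart∣ q d k) (gcd≡⇒∣ q∣rₖ)))
    where
    H⊥K : Coprime H K
    H⊥K = coprime-∣ˡ (qPart∣n h q) (coprime-∣ʳ (qPart∣n k q) h⊥k)
  from : ∃[ l ] (l ≥ 1 × d ≡ q * H * K * l) → gcd (reduce d h) q ≡ q × gcd (reduce d k) q ≡ q
  from (l , _ , d≡) = ∣⇒gcd≡ (Equivalence.from (∣reduce⇔*qPart∣ q d h) qH∣d)
                    , ∣⇒gcd≡ (Equivalence.from (∣reduce⇔*qPart∣ q d k) qK∣d)
    where
    qH∣d : q * H ∣ d
    qH∣d = subst (q * H ∣_) (sym d≡) (∣m⇒∣m*n l (∣m⇒∣m*n K ∣-refl))
    qK∣d : q * K ∣ d
    qK∣d = subst (q * K ∣_) (sym d≡)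
      (∣m⇒∣m*n l (subst (q * K ∣_) (sym (*-assoc q H K)) (*-monoʳ-∣ q (n∣m*n H))))

gcd-reduce≡[1,q]⇔ : ∀ q d h k .{{_ : NonZero q}} .{{_ : NonZero h}} .{{_ : NonZero k}} → d ≥ 1 →
  q ∣ h → Coprime q k →
  (gcd (reduce d h) q ≡ 1 × gcd (reduce d k) q ≡ q)
    ⇔ (∃[ m ] ∃[ l ] (l ≥ 1 × gcd l q ≡ 1 × m ∣ (qPart h q / q) × d ≡ q * m * l))
gcd-reduce≡[1,q]⇔ q d h k d≥1 q∣h q⊥k = mk⇔ to from
  where
  instance _ = >-nonZero d≥1
  H = qPart h q
  q∣H : q ∣ H
  q∣H = ∣⇒∣qPart h q∣h
  to : gcd (reduce d h) q ≡ 1 × gcd (reduce d k) q ≡ q →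
       ∃[ m ] ∃[ l ] (l ≥ 1 × gcd l q ≡ 1 × m ∣ (H / q) × d ≡ q * m * l)
  to (rₕ⊥q , q∣rₖ) = D / q , L , >-nonZero⁻¹ L {{qComplement-nonZero d q}}
                   , coprime⇒gcd≡1 (qComplement-coprime d q) , D/q∣H/q , d≡
    where
    D = qPart d q
    L = qComplement d q
    q∣D : q ∣ D
    q∣D = ∣⇒∣qPart d (∣-trans (gcd≡⇒∣ q∣rₖ) (reduce∣ d k))
    D∣H : D ∣ H
    D∣H = let e , D∣q^e = qPart∣q^ d q in ∣q^e⇒∣qPart h e D∣q^e
      (coprime-reduce⇒∣ h (qPart∣n d q) (∣q^e⇒coprime e D∣q^e (coprime-sym (gcd≡1⇒coprime rₕ⊥q))))
    D/q∣H/q : D / q ∣ H / q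
    D/q∣H/q = m∣n*o⇒m/n∣o q∣D (subst (D ∣_) (sym (m/n*n≡m q∣H)) D∣H)
    d≡ : d ≡ q * (D / q) * L
    d≡ = sym (trans (cong (_* L) (m*[n/m]≡n q∣D)) (qPart*qComplement d q))
  from : ∃[ m ] ∃[ l ] (l ≥ 1 × gcd l q ≡ 1 × m ∣ (H / q) × d ≡ q * m * l) →
         gcd (reduce d h) q ≡ 1 × gcd (reduce d k) q ≡ q
  from (m , l , _ , l⊥q , m∣H/q , d≡) = coprime⇒gcd≡1 rₕ⊥q , ∣⇒gcd≡ q∣rₖ
    where
    q∣rₖ : q ∣ reduce d k
    q∣rₖ = ∣⇒∣reduce q⊥k (subst (q ∣_) (sym d≡) (∣m⇒∣m*n l (m∣m*n m)))
    qm∣h : q * m ∣ h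
    qm∣h = ∣-trans (m∣n/o⇒o*m∣n q∣H m∣H/q) (qPart∣n h q)
    rₕ∣l : reduce d h ∣ l
    rₕ∣l = subst (λ x → reduce x h ∣ l) (sym d≡) (reduce-*∣ qm∣h)
    rₕ⊥q : Coprime (reduce d h) q
    rₕ⊥q = coprime-∣ˡ rₕ∣l (gcd≡1⇒coprime l⊥q)

coprime-reduce∧∣reduce⇒∣ : ∀ {q d h k} .{{_ : NonZero h}} .{{_ : NonZero k}} →
  Coprime (reduce d h) q → q ∣ reduce d k → q ∣ h
coprime-reduce∧∣reduce⇒∣ {q} {d} {h} {k} rₕ⊥q q∣rₖ =
  coprime-reduce⇒∣ h (∣-trans q∣rₖ (reduce∣ d k)) (coprime-sym rₕ⊥q)

lemma6p1 : (q h k : ℕ) → .{{_ : NonZero q}} → .{{_ : NonZero h}} → .{{_ : NonZero k}} →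
  Coprime h k →
  ((d : ℕ) → d ≥ 1 →
      ((gcd (reduce d h) q ≡ 1 × gcd (reduce d k) q ≡ 1) ⇔ gcd d q ≡ 1))
  × ((d : ℕ) → d ≥ 1 →
      ((gcd (reduce d h) q ≡ q × gcd (reduce d k) q ≡ q)
        ⇔ (∃[ l ] (l ≥ 1 × d ≡ q * qPart h q * qPart k q * l))))
  × (q ∣ h → (d : ℕ) → d ≥ 1 →
      ((gcd (reduce d h) q ≡ 1 × gcd (reduce d k) q ≡ q)
        ⇔ (∃[ m ] ∃[ l ] (l ≥ 1 × gcd l q ≡ 1 × m ∣ (qPart h q / q) × d ≡ q * m * l))))
  × (¬ (q ∣ h) → (d : ℕ) → d ≥ 1 →
      ¬ (gcd (reduce d h) q ≡ 1 × gcd (reduce d k) q ≡ q))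
  × (q ∣ k → (d : ℕ) → d ≥ 1 →
      ((gcd (reduce d h) q ≡ q × gcd (reduce d k) q ≡ 1)
        ⇔ (∃[ n ] ∃[ l ] (l ≥ 1 × gcd l q ≡ 1 × n ∣ (qPart k q / q) × d ≡ q * n * l))))
  × (¬ (q ∣ k) → (d : ℕ) → d ≥ 1 →
      ¬ (gcd (reduce d h) q ≡ q × gcd (reduce d k) q ≡ 1))
lemma6p1 q h k h⊥k =
    (λ d _ → gcd-reduce≡[1,1]⇔gcd≡1 q d h k h⊥k)
  , (λ d d≥1 → gcd-reduce≡[q,q]⇔ q d h k d≥1 h⊥k)
  , (λ q∣h d d≥1 → gcd-reduce≡[1,q]⇔ q d h k d≥1 q∣h (coprime-∣ˡ q∣h h⊥k))
  , (λ q∤h d _ (rₕ⊥q , q∣rₖ) →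
       q∤h (coprime-reduce∧∣reduce⇒∣ {q} {d} (gcd≡1⇒coprime rₕ⊥q) (gcd≡⇒∣ q∣rₖ)))
  , (λ q∣k d d≥1 → ⇔.trans (mk⇔ swap swap)
       (gcd-reduce≡[1,q]⇔ q d k h d≥1 q∣k (coprime-∣ˡ q∣k (coprime-sym h⊥k))))
  , (λ q∤k d _ (q∣rₕ , rₖ⊥q) →
       q∤k (coprime-reduce∧∣reduce⇒∣ {q} {d} (gcd≡1⇒coprime rₖ⊥q) (gcd≡⇒∣ q∣rₕ)))
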